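{- For every tree presentation $T$, the structure $\mathcal{L}^*_T$ is ultrahomogeneous: every isomorphism between finite substructures of $\mathcal{L}^*_T$ extends to an automorphism of $\mathcal{L}^*_T$.
   Context: Tree presentations are finite trees whose nodes are finite sequences of positive integers, each node labelled $\ell$ (leaf), $s$ (sum) or $\sigma$ (shuffle), defined inductively: $1$ is the tree consisting only of the root $\langle\rangle$, labelled $\ell$; if $T_1,\dots,T_k$ ($k\ge1$) are tree presentations then $s(T_1,\dots,T_k)$ (resp. $\sigma(T_1,\dots,T_k)$) is the tree whose nodes are the root $\langle\rangle$, labelled $s$ (resp. $\sigma$), together with the nodes $\langle i\rangle^\frown t$ for $1\le i\le k$ and $t\in T_i$, labelled as $t$ is in $T_i$. For a sequence $u$ and $i\le|u|$, $u\upharpoonright i$ is its initial segment of length $i$. Fix once and for all a partition $\langle\mathbb{Q}_n\rangle_{n\ge1}$ of $\mathbb{Q}$ into sets each dense in $\mathbb{Q}$, with $n\in\mathbb{Q}_n$. For $q\in\mathbb{Q}$ let $\#(q)$ be the $n$ with $q\in\mathbb{Q}_n$; for $\bar r=\langle r_0,\dots,r_{m-1}\rangle$ let $\#(\bar r)=\langle\#(r_0),\dots,\#(r_{m-1})\rangle$. $\mathcal{L}_T$ is the set of finite sequences $\bar r$ of rationals such that $\#(\bar r)$ is a leaf of $T$ and for each $i<|\bar r|$, if $\#(\bar r)\upharpoonright i$ is a sum node then $r_i=\#(r_i)$, ordered lexicographically. For a node $t$, $D_t$ is the set of $\bar r\in\mathcal{L}_T$ such that $\#(\bar r)$ extends $t$.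 $\mathcal{L}^*_T$ is the expansion of $(\mathcal{L}_T,<)$ by binary relations $E_t$ ($t\in T$), where $\bar r\,E_t\,\bar s$ iff $\bar r,\bar s\in D_t$ and $\bar r\upharpoonright|t|=\bar s\upharpoonright|t|$. -}

module Defs where

open import Data.Nat using (ℕ; zero; suc; _≤_; _<_)
open import Data.Integer using (+_)
open import Data.Rational as ℚ using (ℚ; _/_)
open import Data.List using (List; []; _∷_; map; take; length; lookup)
open import Data.List.Relation.Binary.Lex.Strict using (Lex-<)
open import Data.Maybe using (Maybe; just; nothing)
open import Data.Fin using (Fin; toℕ)
open import Data.Product using (Σ; ∃; _×_; _,_)
open import Data.Vec as Vec using (Vec)
open import Relation.Binary.PropositionalEquality using (_≡_)
open import Function.Bundles using (_⇔_)

-- Tree presentations.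
-- node k T₁ [T₂,…,T_k] is s(T₁,…,T_k) (k = sumK) or σ(T₁,…,T_k) (k = shufK);
-- the first child is separate so that k ≥ 1 is enforced.

data Kind : Set where
  sumK shufK : Kind

data Tree : Set where
  leaf : Tree
  node : Kind → Tree → List Tree → Tree

data Label : Set where
  ℓL sL σL : Label

kindLabel : Kind → Label
kindLabel sumK  = sL
kindLabel shufK = σL

-- Node sets: sequences of positive integers (as ℕ, children numbered 1..k).
-- lab T u = just (label of u) if u is a node of T, nothing otherwise.
mutual
  lab : Tree → List ℕ → Maybe Label
  lab leaf []              = just ℓL
  lab (node k t ts) []     = just (kindLabel k)
  lab leaf (_ ∷ _)         = nothing
  lab (node k t ts) (i ∷ u) = labCh (t ∷ ts) i u

  labCh : List Tree → ℕ → List ℕ → Maybe Label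
  labCh []       _             _ = nothing
  labCh (t ∷ ts) zero          _ = nothing
  labCh (t ∷ ts) (suc zero)    u = lab t u
  labCh (t ∷ ts) (suc (suc i)) u = labCh ts (suc i) u

IsNode : Tree → List ℕ → Set
IsNode T t = ∃ λ l → lab T t ≡ just l

-- A partition ⟨ℚ_n⟩_{n≥1} of ℚ into dense sets with n ∈ ℚ_n,
-- presented by its index function # (q ∈ ℚ_n  iff  # q ≡ n).

ℕtoℚ : ℕ → ℚ
ℕtoℚ n = + n / 1

record DensePartition : Set where
  field
    #       : ℚ → ℕ
    #-pos   : ∀ q → 1 ≤ # q
    #-self  : ∀ n → 1 ≤ n → # (ℕtoℚ n) ≡ n
    #-dense : ∀ n → 1 ≤ n → ∀ p q → p ℚ.< q →
              Σ ℚ λ r → (p ℚ.< r) × (r ℚ.< q) × (# r ≡ n)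

module Structure (P : DensePartition) (T : Tree) where
  open DensePartition P

  #s : List ℚ → List ℕ
  #s = map #

  InL : List ℚ → Set
  InL r = (lab T (#s r) ≡ just ℓL)
        × (∀ (i : Fin (length r)) → lab T (take (toℕ i) (#s r)) ≡ just sL →
             lookup r i ≡ ℕtoℚ (# (lookup r i)))

  _<L_ : List ℚ → List ℚ → Set
  _<L_ = Lex-< _≡_ ℚ._<_

  D : List ℕ → List ℚ → Set
  D t r = InL r × (take (length t) (#s r) ≡ t)

  E : List ℕ → List ℚ → List ℚ → Set
  E t r s = D t r × D t s × (take (length t) r ≡ take (length t) s)

  record Automorphism : Set where
    field
      f g      : List ℚ → List ℚ
      f-L      : ∀ r → InL r → InL (f r)
      g-L      : ∀ r → InL r → InL (g r)
      gf       : ∀ r → InL r → g (f r) ≡ r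
      fg       : ∀ r → InL r → f (g r) ≡ r
      f-<      : ∀ r s → InL r → InL s → (r <L s) ⇔ (f r <L f s)
      f-E      : ∀ t → IsNode T t → ∀ r s → InL r → InL s →
                 E t r s ⇔ E t (f r) (f s)

  record FinitePartialIso (n : ℕ) (a b : Vec (List ℚ) n) : Set where
    field
      a-L    : ∀ i → InL (Vec.lookup a i)
      b-L    : ∀ i → InL (Vec.lookup b i)
      bij    : ∀ i j → (Vec.lookup a i ≡ Vec.lookup a j) ⇔ (Vec.lookup b i ≡ Vec.lookup b j)
      pres-< : ∀ i j → (Vec.lookup a i <L Vec.lookup a j) ⇔ (Vec.lookup b i <L Vec.lookup b j)
      pres-E : ∀ t → IsNode T t → ∀ i j →
               E t (Vec.lookup a i) (Vec.lookup a j) ⇔ E t (Vec.lookup b i) (Vec.lookup b j)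

  Ultrahomogeneous : Set
  Ultrahomogeneous =
    ∀ (n : ℕ) (a b : Vec (List ℚ) n) → FinitePartialIso n a b →
    Σ Automorphism λ σ → ∀ i → Automorphism.f σ (Vec.lookup a i) ≡ Vec.lookup b i

-- Call the profile of two sequences of rationals the length of their longest common
-- prefix together with their lexicographic comparison. For elements of 𝓛_T with the same
-- #-image the profile determines <, = and every E_t between them, and conversely (E_t for
-- t the #-image of the common prefix recovers its length), so an isomorphism between
-- finite substructures is a finite partial map preserving #-images and profiles.
-- Such a map extends to a new point x: choose a domain point a sharing the longest
-- prefix u (of length k) with x, and map x to v ++ z ∷ (the tail of x after position k),
-- where v is the first k entries of the image of a. The entry z must have the same
-- # as x_k and sit, relative to the k-th entries of the images of the domain points
-- beginning with u, where x_k sits relative to theirs: below a sum node it is forced to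
-- be x_k, below a shuffle node it exists because each ℚ_n is dense. As the finite
-- sequences of rationals can be enumerated, a back-and-forth along the enumeration
-- produces the automorphism.

module Submission where

open import Defs
open import Data.Nat as ℕ using (ℕ; zero; suc; _≤_; _<_; z≤n; s≤s; _+_; _≤?_; _≤′_; ≤′-refl; ≤′-step)
import Data.Nat.Properties as ℕP
open import Data.Integer as ℤ using (ℤ; +_; -[1+_])
open import Data.Rational as ℚ using (ℚ; ↥_; 0ℚ; 1ℚ; _<?_)
import Data.Rational.Properties as ℚP
open import Data.List
  using (List; []; _∷_; _++_; take; drop; length; map; filter; lookup; allFin; cartesianProductWith)
open import Data.List.Properties
  using (∷-injective; map-++; take-map; length-map; length-take; ++-assoc; ++-identityʳ; take++drop≡id; ++-cancelˡ; take-all)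
import Data.List.Properties as List
open import Data.List.Membership.Propositional using (_∈_; find)
open import Data.List.Membership.Propositional.Properties
  using (∈-map⁺; ∈-map⁻; ∈-++⁺ˡ; ∈-++⁺ʳ; ∈-cartesianProductWith⁺; ∈-map∘filter⁺; ∈-map∘filter⁻; ∈-allFin)
open import Data.List.Relation.Unary.Any as Any using (here; there)
import Data.List.Relation.Unary.All as All
open import Data.List.Relation.Binary.Lex.Strict using (Lex-<)
open import Data.List.Relation.Binary.Lex.Core using (halt; this; next; base)
open import Data.List.Extrema ℕP.≤-totalOrder using (argmax; argmax-all; f[⊥]≤f[argmax]; f[xs]≤f[argmax])
open import Data.Maybe using (just)
import Data.Maybe.Properties as Maybe
open import Data.Fin using (Fin; toℕ) renaming (zero to fzero; suc to fsuc)
open import Data.Vec as Vec using (Vec)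
open import Data.Product using (Σ; ∃; _×_; _,_; proj₁; proj₂; swap)
open import Data.Sum using (_⊎_; inj₁; inj₂)
open import Data.Unit using (⊤; tt)
open import Data.Empty using (⊥-elim)
open import Relation.Nullary using (Dec; yes; no)
open import Relation.Nullary.Decidable using (toWitness; _×-dec_; _→-dec_)
open import Relation.Binary.Definitions using (tri<; tri≈; tri>)
open import Relation.Binary.PropositionalEquality
open import Function.Base using (_∘_)
open import Function.Bundles using (mk⇔; Equivalence)

take-++-take : ∀ {A : Set} k (l w : List A) → k ≤ length l → take k (take k l ++ w) ≡ take k l
take-++-take zero    _       _ _       = refl
take-++-take (suc k) (x ∷ l) w (s≤s h) = cong (x ∷_) (take-++-take k l w h)

length-take≤ : ∀ {A : Set} k (l : List A) → k ≤ length l → length (take k l) ≡ k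
length-take≤ k l k≤ = trans (length-take k l) (ℕP.m≤n⇒m⊓n≡m k≤)

entry : List ℚ → ℕ → ℚ
entry []      _       = ℚ.0ℚ
entry (x ∷ r) zero    = x
entry (x ∷ r) (suc k) = entry r k

split-at : ∀ k r → k < length r → r ≡ take k r ++ entry r k ∷ drop (suc k) r
split-at zero    (x ∷ r) _       = refl
split-at (suc k) (x ∷ r) (s≤s h) = cong (x ∷_) (split-at k r h)

∈-map-swap⁻ : ∀ {A B : Set} {p : A × B} {ps} → p ∈ map swap ps → swap p ∈ ps
∈-map-swap⁻ p∈ with ∈-map⁻ swap p∈
... | _ , q∈ , refl = q∈

maximiser : ∀ {A : Set} (f : A → ℕ) (a : A) (as : List A) →
            Σ A λ m → m ∈ a ∷ as × (∀ {b} → b ∈ a ∷ as → f b ≤ f m)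
maximiser f a as = argmax f a as , argmax-all f (here refl) (All.tabulate there) , bound
  where
  bound : ∀ {b} → b ∈ a ∷ as → f b ≤ f (argmax f a as)
  bound (here refl) = f[⊥]≤f[argmax] {f = f} a as
  bound (there b∈)  = All.lookup (f[xs]≤f[argmax] {f = f} a as) b∈

-- Profiles

data Ordering : Set where
  less equal greater : Ordering

opposite : Ordering → Ordering
opposite less    = greater
opposite equal   = equal
opposite greater = less

compareℚ : ℚ → ℚ → Ordering
compareℚ x y with ℚP.<-cmp x y
... | tri< _ _ _ = less
... | tri≈ _ _ _ = equal
... | tri> _ _ _ = greater

compareℚ-less⁻ : ∀ {x y} → compareℚ x y ≡ less → x ℚ.< y
compareℚ-less⁻ {x} {y} e with ℚP.<-cmp x y
compareℚ-less⁻ e  | tri< x<y _ _ = x<y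
compareℚ-less⁻ () | tri≈ _ _ _
compareℚ-less⁻ () | tri> _ _ _

compareℚ-equal⁻ : ∀ {x y} → compareℚ x y ≡ equal → x ≡ y
compareℚ-equal⁻ {x} {y} e with ℚP.<-cmp x y
compareℚ-equal⁻ () | tri< _ _ _
compareℚ-equal⁻ e  | tri≈ _ x≡y _ = x≡y
compareℚ-equal⁻ () | tri> _ _ _

compareℚ-less⁺ : ∀ {x y} → x ℚ.< y → compareℚ x y ≡ less
compareℚ-less⁺ {x} {y} x<y with ℚP.<-cmp x y
... | tri< _ _ _   = refl
... | tri≈ x≮y _ _ = ⊥-elim (x≮y x<y)
... | tri> x≮y _ _ = ⊥-elim (x≮y x<y)

compareℚ-greater⁺ : ∀ {x y} → y ℚ.< x → compareℚ x y ≡ greater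
compareℚ-greater⁺ {x} {y} y<x with ℚP.<-cmp x y
... | tri< _ _ y≮x = ⊥-elim (y≮x y<x)
... | tri≈ _ _ y≮x = ⊥-elim (y≮x y<x)
... | tri> _ _ _   = refl

compareℚ-refl : ∀ x → compareℚ x x ≡ equal
compareℚ-refl x with ℚP.<-cmp x x
... | tri< x<x _ _ = ⊥-elim (ℚP.<-irrefl refl x<x)
... | tri≈ _ _ _   = refl
... | tri> _ _ x<x = ⊥-elim (ℚP.<-irrefl refl x<x)

compareℚ-sym : ∀ x y → compareℚ y x ≡ opposite (compareℚ x y)
compareℚ-sym x y with ℚP.<-cmp x y
... | tri< x<y _ _  = compareℚ-greater⁺ x<y
... | tri≈ _ refl _ = compareℚ-refl x
... | tri> _ _ y<x  = compareℚ-less⁺ y<x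

compareℚ-greater⁻ : ∀ {x y} → compareℚ x y ≡ greater → y ℚ.< x
compareℚ-greater⁻ {x} {y} e = compareℚ-less⁻ (trans (compareℚ-sym x y) (cong opposite e))

Profile : Set
Profile = ℕ × Ordering

extendProfile : Ordering → Profile → Profile
extendProfile less    _       = 0 , less
extendProfile equal   (n , o) = suc n , o
extendProfile greater _       = 0 , greater

profile : List ℚ → List ℚ → Profile
profile []       []       = 0 , equal
profile []       (_ ∷ _)  = 0 , less
profile (_ ∷ _)  []       = 0 , greater
profile (x ∷ r)  (y ∷ s)  = extendProfile (compareℚ x y) (profile r s)

commonPrefix : List ℚ → List ℚ → ℕ
commonPrefix r s = proj₁ (profile r s)

lexOrder : List ℚ → List ℚ → Ordering
lexOrder r s = proj₂ (profile r s)

oppositeProfile : Profile → Profile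
oppositeProfile (n , o) = n , opposite o

shiftProfile : ℕ → Profile → Profile
shiftProfile k (n , o) = k + n , o

shiftProfile-injective : ∀ k {R R′} → shiftProfile k R ≡ shiftProfile k R′ → R ≡ R′
shiftProfile-injective k {n , _} {n′ , _} e with ℕP.+-cancelˡ-≡ k n n′ (cong proj₁ e) | cong proj₂ e
... | refl | refl = refl

extendProfile-≢equal : ∀ {o} R R′ → o ≢ equal → extendProfile o R ≡ extendProfile o R′
extendProfile-≢equal {less}    _ _ _   = refl
extendProfile-≢equal {equal}   _ _ o≢e = ⊥-elim (o≢e refl)
extendProfile-≢equal {greater} _ _ _   = refl

extendProfile-equal : ∀ R → 1 ≤ proj₁ (extendProfile equal R)
extendProfile-equal _ = s≤s z≤n

extendProfile-injectiveˡ : ∀ o o′ {R R′} → extendProfile o R ≡ extendProfile o′ R′ → o ≡ o′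
extendProfile-injectiveˡ less    less    _  = refl
extendProfile-injectiveˡ less    equal   ()
extendProfile-injectiveˡ less    greater ()
extendProfile-injectiveˡ equal   less    ()
extendProfile-injectiveˡ equal   equal   _  = refl
extendProfile-injectiveˡ equal   greater ()
extendProfile-injectiveˡ greater less    ()
extendProfile-injectiveˡ greater equal   ()
extendProfile-injectiveˡ greater greater _  = refl

profile-refl : ∀ r → profile r r ≡ (length r , equal)
profile-refl []      = refl
profile-refl (x ∷ r) rewrite compareℚ-refl x | profile-refl r = refl

profile-sym : ∀ r s → profile s r ≡ oppositeProfile (profile r s)
profile-sym []      []      = refl
profile-sym []      (_ ∷ _) = refl
profile-sym (_ ∷ _) []      = refl
profile-sym (x ∷ r) (y ∷ s) rewrite compareℚ-sym x y | profile-sym r s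
  with compareℚ x y
... | less    = refl
... | equal   = refl
... | greater = refl

lexOrder-equal⁻ : ∀ r s → lexOrder r s ≡ equal → r ≡ s
lexOrder-equal⁻ []      []      _ = refl
lexOrder-equal⁻ []      (_ ∷ _) ()
lexOrder-equal⁻ (_ ∷ _) []      ()
lexOrder-equal⁻ (x ∷ r) (y ∷ s) e with compareℚ x y in x≟y
... | equal = cong₂ _∷_ (compareℚ-equal⁻ x≟y) (lexOrder-equal⁻ r s e)

profile-≡⇒≡ : ∀ {r s r′ s′} → profile r s ≡ profile r′ s′ → r ≡ s → r′ ≡ s′
profile-≡⇒≡ {r} {_} {r′} {s′} e refl =
  lexOrder-equal⁻ r′ s′ (trans (cong proj₂ (sym e)) (cong proj₂ (profile-refl r)))

commonPrefix≤length : ∀ r s → commonPrefix r s ≤ length r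
commonPrefix≤length []      []      = z≤n
commonPrefix≤length []      (_ ∷ _) = z≤n
commonPrefix≤length (_ ∷ _) []      = z≤n
commonPrefix≤length (x ∷ r) (y ∷ s) with compareℚ x y
... | less    = z≤n
... | equal   = s≤s (commonPrefix≤length r s)
... | greater = z≤n

commonPrefix≤lengthʳ : ∀ r s → commonPrefix r s ≤ length s
commonPrefix≤lengthʳ r s =
  subst (_≤ length s) (cong proj₁ (sym (profile-sym s r))) (commonPrefix≤length s r)

take-commonPrefix : ∀ {k} r s → k ≤ commonPrefix r s → take k r ≡ take k s
take-commonPrefix {zero}  _       _       _ = refl
take-commonPrefix {suc k} []      []      ()
take-commonPrefix {suc k} []      (_ ∷ _) ()
take-commonPrefix {suc k} (_ ∷ _) []      ()
take-commonPrefix {suc k} (x ∷ r) (y ∷ s) k<cp with compareℚ x y in x≟y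
take-commonPrefix {suc k} (x ∷ r) (y ∷ s) (s≤s k≤cp) | equal =
  cong₂ _∷_ (compareℚ-equal⁻ x≟y) (take-commonPrefix r s k≤cp)

commonPrefix-take : ∀ k r s → take k r ≡ take k s → k ≤ commonPrefix r s ⊎ r ≡ s
commonPrefix-take zero    _       _       _ = inj₁ z≤n
commonPrefix-take (suc k) []      []      _ = inj₂ refl
commonPrefix-take (suc k) []      (_ ∷ _) ()
commonPrefix-take (suc k) (_ ∷ _) []      ()
commonPrefix-take (suc k) (x ∷ r) (y ∷ s) e with ∷-injective e
... | refl , e′ rewrite compareℚ-refl x with commonPrefix-take k r s e′
...   | inj₁ k≤cp = inj₁ (s≤s k≤cp)
...   | inj₂ refl = inj₂ refl

take-≡-transfer : ∀ k {r s r′ s′} → profile r s ≡ profile r′ s′ →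
                  take k r ≡ take k s → take k r′ ≡ take k s′
take-≡-transfer k {r} {s} {r′} {s′} e tk with commonPrefix-take k r s tk
... | inj₁ k≤cp = take-commonPrefix r′ s′ (subst (k ≤_) (cong proj₁ e) k≤cp)
... | inj₂ r≡s  = cong (take k) (profile-≡⇒≡ e r≡s)

profile-++ : ∀ v s s′ → profile (v ++ s) (v ++ s′) ≡ shiftProfile (length v) (profile s s′)
profile-++ []      s s′ = refl
profile-++ (x ∷ v) s s′ rewrite compareℚ-refl x | profile-++ v s s′ = refl

profile-beyond-commonPrefix : ∀ k {r r′} s → take k r ≡ take k r′ → commonPrefix r s < k →
                              profile r′ s ≡ profile r s
profile-beyond-commonPrefix zero    _ _ ()
profile-beyond-commonPrefix (suc k) {[]}    {[]}     s _ _ = refl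
profile-beyond-commonPrefix (suc k) {[]}    {_ ∷ _}  s () _
profile-beyond-commonPrefix (suc k) {_ ∷ _} {[]}     s () _
profile-beyond-commonPrefix (suc k) {x ∷ r} {_ ∷ r′} [] e _ with ∷-injective e
... | refl , _ = refl
profile-beyond-commonPrefix (suc k) {x ∷ r} {_ ∷ r′} (y ∷ s) e cp<k with ∷-injective e
... | refl , e′ with compareℚ x y | cp<k
...   | less    | _         = refl
...   | greater | _         = refl
...   | equal   | s≤s cp<k′ = cong (shiftProfile 1) (profile-beyond-commonPrefix k s e′ cp<k′)

Lex-<⇒lexOrder : ∀ {r s} → Lex-< _≡_ ℚ._<_ r s → lexOrder r s ≡ less
Lex-<⇒lexOrder (base ())
Lex-<⇒lexOrder halt = refl
Lex-<⇒lexOrder (this x<y) rewrite compareℚ-less⁺ x<y = refl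
Lex-<⇒lexOrder {x ∷ _} (next refl r<s) rewrite compareℚ-refl x = Lex-<⇒lexOrder r<s

lexOrder⇒Lex-< : ∀ r s → lexOrder r s ≡ less → Lex-< _≡_ ℚ._<_ r s
lexOrder⇒Lex-< []      []      ()
lexOrder⇒Lex-< []      (_ ∷ _) _ = halt
lexOrder⇒Lex-< (_ ∷ _) []      ()
lexOrder⇒Lex-< (x ∷ r) (y ∷ s) e with compareℚ x y in x≟y
... | less  = this (compareℚ-less⁻ x≟y)
... | equal = next (compareℚ-equal⁻ x≟y) (lexOrder⇒Lex-< r s e)

-- Tree presentations

_≟ᴸ_ : (a b : Label) → Dec (a ≡ b)
ℓL ≟ᴸ ℓL = yes refl
ℓL ≟ᴸ sL = no λ ()
ℓL ≟ᴸ σL = no λ ()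
sL ≟ᴸ ℓL = no λ ()
sL ≟ᴸ sL = yes refl
sL ≟ᴸ σL = no λ ()
σL ≟ᴸ ℓL = no λ ()
σL ≟ᴸ sL = no λ ()
σL ≟ᴸ σL = yes refl

mutual
  leaves-prefix-free : ∀ T {u w} → lab T u ≡ just ℓL → lab T w ≡ just ℓL →
                       take (length u) w ≡ u → u ≡ w
  leaves-prefix-free leaf              {[]}    {[]}    _ _ _ = refl
  leaves-prefix-free leaf              {[]}    {_ ∷ _} _ () _
  leaves-prefix-free (node sumK _ _)   {[]}            () _ _
  leaves-prefix-free (node shufK _ _)  {[]}            () _ _
  leaves-prefix-free (node _ _ _)      {_ ∷ _} {[]}    _ _ ()
  leaves-prefix-free (node _ t ts)     {i ∷ u} {_ ∷ w} u-leaf w-leaf e with ∷-injective e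
  ... | refl , e′ = cong (i ∷_) (leaves-prefix-freeᶜ t ts i u-leaf w-leaf e′)

  leaves-prefix-freeᶜ : ∀ t ts i {u w} → labCh (t ∷ ts) i u ≡ just ℓL →
                        labCh (t ∷ ts) i w ≡ just ℓL → take (length u) w ≡ u → u ≡ w
  leaves-prefix-freeᶜ t ts        zero          ()
  leaves-prefix-freeᶜ t ts        (suc zero)    = leaves-prefix-free t
  leaves-prefix-freeᶜ t []        (suc (suc i)) ()
  leaves-prefix-freeᶜ t (t′ ∷ ts) (suc (suc i)) = leaves-prefix-freeᶜ t′ ts (suc i)

root-isNode : ∀ T → IsNode T []
root-isNode leaf         = _ , refl
root-isNode (node _ _ _) = _ , refl

mutual
  take-isNode : ∀ T k {w} → IsNode T w → IsNode T (take k w)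
  take-isNode T             zero    _              = root-isNode T
  take-isNode T             (suc k) {[]}    _      = root-isNode T
  take-isNode leaf          (suc k) {_ ∷ _} (_ , ())
  take-isNode (node _ t ts) (suc k) {i ∷ w} w-node = take-isNodeᶜ t ts i k w-node

  take-isNodeᶜ : ∀ t ts i k {w} → ∃ (λ l → labCh (t ∷ ts) i w ≡ just l) →
                 ∃ λ l → labCh (t ∷ ts) i (take k w) ≡ just l
  take-isNodeᶜ t ts        zero          k (_ , ())
  take-isNodeᶜ t ts        (suc zero)    k = take-isNode t k
  take-isNodeᶜ t []        (suc (suc i)) k (_ , ())
  take-isNodeᶜ t (t′ ∷ ts) (suc (suc i)) k = take-isNodeᶜ t′ ts (suc i) k

-- Density of the parts ℚ_n

maximum : (l : ℚ) (ls : List ℚ) → Σ ℚ λ m → m ∈ l ∷ ls × (∀ {y} → y ∈ l ∷ ls → y ℚ.≤ m)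
maximum l []        = l , here refl , λ { (here refl) → ℚP.≤-refl }
maximum l (l′ ∷ ls) with maximum l′ ls
... | m , m∈ , ≤m with ℚP.≤-total l m
...   | inj₁ l≤m = m , there m∈ , λ { (here refl) → l≤m ; (there y∈) → ≤m y∈ }
...   | inj₂ m≤l = l , here refl , λ { (here refl) → ℚP.≤-refl ; (there y∈) → ℚP.≤-trans (≤m y∈) m≤l }

minimum : (l : ℚ) (ls : List ℚ) → Σ ℚ λ m → m ∈ l ∷ ls × (∀ {y} → y ∈ l ∷ ls → m ℚ.≤ y)
minimum l []        = l , here refl , λ { (here refl) → ℚP.≤-refl }
minimum l (l′ ∷ ls) with minimum l′ ls
... | m , m∈ , m≤ with ℚP.≤-total l m
...   | inj₂ m≤l = m , there m∈ , λ { (here refl) → m≤l ; (there y∈) → m≤ y∈ }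
...   | inj₁ l≤m = l , here refl , λ { (here refl) → ℚP.≤-refl ; (there y∈) → ℚP.≤-trans l≤m (m≤ y∈) }

p<p+1 : ∀ p → p ℚ.< p ℚ.+ 1ℚ
p<p+1 p = subst (ℚ._< p ℚ.+ 1ℚ) (ℚP.+-identityʳ p) (ℚP.+-monoʳ-< p (toWitness {a? = 0ℚ <? 1ℚ} _))

p-1<p : ∀ p → p ℚ.+ (ℚ.- 1ℚ) ℚ.< p
p-1<p p = subst (p ℚ.+ (ℚ.- 1ℚ) ℚ.<_) (ℚP.+-identityʳ p) (ℚP.+-monoʳ-< p (toWitness {a? = ℚ.- 1ℚ <? 0ℚ} _))

module _ (P : DensePartition) where
  open DensePartition P

  between : (Ls Us : List ℚ) → (∀ {l h} → l ∈ Ls → h ∈ Us → l ℚ.< h) → (c : ℕ) → 1 ≤ c →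
            Σ ℚ λ z → # z ≡ c × (∀ {l} → l ∈ Ls → l ℚ.< z) × (∀ {h} → h ∈ Us → z ℚ.< h)
  between []       []       _ c 1≤c = ℕtoℚ c , #-self c 1≤c , (λ ()) , (λ ())
  between (l ∷ ls) []       _ c 1≤c with maximum l ls
  ... | m , _ , ≤m with #-dense c 1≤c m (m ℚ.+ 1ℚ) (p<p+1 m)
  ...   | z , m<z , _ , #z = z , #z , (λ y∈ → ℚP.≤-<-trans (≤m y∈) m<z) , (λ ())
  between []       (h ∷ hs) _ c 1≤c with minimum h hs
  ... | m , _ , m≤ with #-dense c 1≤c (m ℚ.+ (ℚ.- 1ℚ)) m (p-1<p m)
  ...   | z , _ , z<m , #z = z , #z , (λ ()) , (λ y∈ → ℚP.<-≤-trans z<m (m≤ y∈))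
  between (l ∷ ls) (h ∷ hs) L<U c 1≤c with maximum l ls | minimum h hs
  ... | m , m∈ , ≤m | M , M∈ , M≤ with #-dense c 1≤c m M (L<U m∈ M∈)
  ...   | z , m<z , z<M , #z = z , #z , (λ y∈ → ℚP.≤-<-trans (≤m y∈) m<z) , (λ y∈ → ℚP.<-≤-trans z<M (M≤ y∈))

  extend-finiteOrderIso :
    (ps : List (ℚ × ℚ)) →
    (∀ {u w} → u ∈ ps → w ∈ ps → compareℚ (proj₁ u) (proj₁ w) ≡ compareℚ (proj₂ u) (proj₂ w)) →
    (x : ℚ) → (∀ {u} → u ∈ ps → compareℚ x (proj₁ u) ≢ equal) → (c : ℕ) → 1 ≤ c →
    Σ ℚ λ z → # z ≡ c × (∀ {u} → u ∈ ps → compareℚ z (proj₂ u) ≡ compareℚ x (proj₁ u))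
  extend-finiteOrderIso ps order-pres x x∉ c 1≤c with between below above below<above c 1≤c
    where
    below above : List ℚ
    below = map proj₂ (filter (λ u → proj₁ u <? x) ps)
    above = map proj₂ (filter (λ u → x <? proj₁ u) ps)
    below<above : ∀ {l h} → l ∈ below → h ∈ above → l ℚ.< h
    below<above l∈ h∈ with ∈-map∘filter⁻ proj₂ _ l∈ | ∈-map∘filter⁻ proj₂ _ h∈
    ... | u , u∈ , refl , u<x | w , w∈ , refl , x<w =
      compareℚ-less⁻ (trans (sym (order-pres u∈ w∈)) (compareℚ-less⁺ (ℚP.<-trans u<x x<w)))
  ... | z , #z , below<z , z<above = z , #z , same-cut
    where
    same-cut : ∀ {u} → u ∈ ps → compareℚ z (proj₂ u) ≡ compareℚ x (proj₁ u)
    same-cut {u} u∈ with compareℚ x (proj₁ u) in x≟u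
    ... | less    = compareℚ-less⁺ (z<above (∈-map∘filter⁺ proj₂ _ (u , u∈ , refl , compareℚ-less⁻ x≟u)))
    ... | greater = compareℚ-greater⁺ (below<z (∈-map∘filter⁺ proj₂ _ (u , u∈ , refl , compareℚ-greater⁻ x≟u)))
    ... | equal   = ⊥-elim (x∉ u∈ x≟u)

-- An enumeration of the finite sequences of rationals

integersUpTo : ℕ → List ℤ
integersUpTo zero    = + 0 ∷ []
integersUpTo (suc n) = + suc n ∷ -[1+ n ] ∷ integersUpTo n

∈-integersUpTo : ∀ n i → ℤ.∣ i ∣ ≤ n → i ∈ integersUpTo n
∈-integersUpTo zero    (+ zero)  _ = here refl
∈-integersUpTo (suc n) (+ m)     h with m ℕ.≟ suc n
... | yes refl = here refl
... | no  m≢   = there (there (∈-integersUpTo n (+ m) (ℕP.≤-pred (ℕP.≤∧≢⇒< h m≢))))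
∈-integersUpTo (suc n) -[1+ m ]  h with m ℕ.≟ n
... | yes refl = there (here refl)
... | no  m≢   = there (there (∈-integersUpTo n -[1+ m ] (ℕP.≤∧≢⇒< (ℕP.≤-pred h) m≢)))

rationalsUpTo : ℕ → ℕ → List ℚ
rationalsUpTo m zero    = []
rationalsUpTo m (suc d) = map (ℚ._/ suc d) (integersUpTo m) ++ rationalsUpTo m d

∈-rationalsUpTo : ∀ m n q → ℤ.∣ ↥ q ∣ ≤ m → ℚ.denominator-1 q < n → q ∈ rationalsUpTo m n
∈-rationalsUpTo m (suc n) q num≤m den≤n with ℚ.denominator-1 q ℕ.≟ n
... | yes refl = ∈-++⁺ˡ (subst (_∈ map (ℚ._/ suc n) (integersUpTo m)) (ℚP.↥p/↧p≡p q)
                          (∈-map⁺ (ℚ._/ suc n) (∈-integersUpTo m (↥ q) num≤m)))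
... | no  d≢n  = ∈-++⁺ʳ _ (∈-rationalsUpTo m n q num≤m (ℕP.≤∧≢⇒< (ℕP.≤-pred den≤n) d≢n))

sizeℚ : ℚ → ℕ
sizeℚ q = ℤ.∣ ↥ q ∣ + suc (ℚ.denominator-1 q)

∈-rationalsUpTo-size : ∀ n q → sizeℚ q ≤ n → q ∈ rationalsUpTo n n
∈-rationalsUpTo-size n q h = ∈-rationalsUpTo n n q (ℕP.m+n≤o⇒m≤o _ h) (ℕP.m+n≤o⇒n≤o ℤ.∣ ↥ q ∣ h)

size : List ℚ → ℕ
size []      = 0
size (q ∷ r) = suc (sizeℚ q + size r)

listsUpTo : ℕ → List (List ℚ)
listsUpTo zero    = [] ∷ []
listsUpTo (suc n) = [] ∷ cartesianProductWith _∷_ (rationalsUpTo (suc n) (suc n)) (listsUpTo n)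

∈-listsUpTo : ∀ n r → size r ≤ n → r ∈ listsUpTo n
∈-listsUpTo zero    []      _ = here refl
∈-listsUpTo (suc n) []      _ = here refl
∈-listsUpTo (suc n) (q ∷ r) (s≤s h) =
  there (∈-cartesianProductWith⁺ _∷_ (∈-rationalsUpTo-size (suc n) q (ℕP.m≤n⇒m≤1+n (ℕP.m+n≤o⇒m≤o _ h)))
                                     (∈-listsUpTo n r (ℕP.m+n≤o⇒n≤o (sizeℚ q) h)))

-- Ultrahomogeneity of 𝓛*_T

module _ (P : DensePartition) (T : Tree) where
  open DensePartition P
  open Structure P T

  -- Membership in 𝓛_T in a recursive, decidable form: in SumCanonical pre r, pre is the
  -- #-image of the part of the sequence already read, and every later entry sitting
  -- at a sum node must be the natural number it is the #-index of.
  SumCanonical : List ℕ → List ℚ → Set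
  SumCanonical pre []      = ⊤
  SumCanonical pre (q ∷ r) = (lab T pre ≡ just sL → q ≡ ℕtoℚ (# q)) × SumCanonical (pre ++ # q ∷ []) r

  InLᵣ : List ℚ → Set
  InLᵣ r = lab T (#s r) ≡ just ℓL × SumCanonical [] r

  sumCanonical? : ∀ pre r → Dec (SumCanonical pre r)
  sumCanonical? pre []      = yes tt
  sumCanonical? pre (q ∷ r) =
    ((Maybe.≡-dec _≟ᴸ_ (lab T pre) (just sL)) →-dec (q ℚ.≟ ℕtoℚ (# q))) ×-dec sumCanonical? (pre ++ # q ∷ []) r

  inLᵣ? : ∀ r → Dec (InLᵣ r)
  inLᵣ? r = Maybe.≡-dec _≟ᴸ_ (lab T (#s r)) (just ℓL) ×-dec sumCanonical? [] r

  private
    IndexedSumCanonical : List ℕ → List ℚ → Set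
    IndexedSumCanonical pre r = ∀ (i : Fin (length r)) → lab T (pre ++ take (toℕ i) (#s r)) ≡ just sL →
                                lookup r i ≡ ℕtoℚ (# (lookup r i))

    indexed⇒sumCanonical : ∀ pre r → IndexedSumCanonical pre r → SumCanonical pre r
    indexed⇒sumCanonical pre []      _ = tt
    indexed⇒sumCanonical pre (q ∷ r) h =
      (λ e → h fzero (subst (λ w → lab T w ≡ just sL) (sym (++-identityʳ pre)) e)) ,
      indexed⇒sumCanonical (pre ++ # q ∷ []) r (λ i e → h (fsuc i)
        (subst (λ w → lab T w ≡ just sL) (++-assoc pre (# q ∷ []) (take (toℕ i) (#s r))) e))

    sumCanonical⇒indexed : ∀ pre r → SumCanonical pre r → IndexedSumCanonical pre r
    sumCanonical⇒indexed pre (q ∷ r) (h , _) fzero e =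
      h (subst (λ w → lab T w ≡ just sL) (++-identityʳ pre) e)
    sumCanonical⇒indexed pre (q ∷ r) (_ , h) (fsuc i) e = sumCanonical⇒indexed (pre ++ # q ∷ []) r h i
      (subst (λ w → lab T w ≡ just sL) (sym (++-assoc pre (# q ∷ []) (take (toℕ i) (#s r)))) e)

  InL⇒InLᵣ : ∀ {r} → InL r → InLᵣ r
  InL⇒InLᵣ {r} (isLeaf , canonical) = isLeaf , indexed⇒sumCanonical [] r canonical

  InLᵣ⇒InL : ∀ {r} → InLᵣ r → InL r
  InLᵣ⇒InL {r} (isLeaf , canonical) = isLeaf , sumCanonical⇒indexed [] r canonical

  sumCanonical-++⁻ : ∀ pre u w → SumCanonical pre (u ++ w) → SumCanonical pre u × SumCanonical (pre ++ #s u) w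
  sumCanonical-++⁻ pre []      w h rewrite ++-identityʳ pre = tt , h
  sumCanonical-++⁻ pre (q ∷ u) w (h , hs) with sumCanonical-++⁻ (pre ++ # q ∷ []) u w hs
  ... | hu , hw = (h , hu) , subst (λ p → SumCanonical p w) (++-assoc pre (# q ∷ []) (#s u)) hw

  sumCanonical-++⁺ : ∀ pre u w → SumCanonical pre u → SumCanonical (pre ++ #s u) w → SumCanonical pre (u ++ w)
  sumCanonical-++⁺ pre []      w _        hw rewrite ++-identityʳ pre = hw
  sumCanonical-++⁺ pre (q ∷ u) w (h , hu) hw = h , sumCanonical-++⁺ (pre ++ # q ∷ []) u w hu
    (subst (λ p → SumCanonical p w) (sym (++-assoc pre (# q ∷ []) (#s u))) hw)

  length-#s : ∀ r → length (#s r) ≡ length r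
  length-#s = length-map #

  #s-≡⇒length-≡ : ∀ {r s} → #s r ≡ #s s → length r ≡ length s
  #s-≡⇒length-≡ {r} {s} e = trans (sym (length-#s r)) (trans (cong length e) (length-#s s))

  InLᵣ-prefix-free : ∀ {r s} → InLᵣ r → InLᵣ s → take (length r) s ≡ r → r ≡ s
  InLᵣ-prefix-free {r} {s} (r-leaf , _) (s-leaf , _) s≥r =
    trans (sym s≥r) (trans (cong (λ n → take n s) (#s-≡⇒length-≡ #r≡#s)) (take-all (length s) s ℕP.≤-refl))
    where
    #s≥#r : take (length (#s r)) (#s s) ≡ #s r
    #s≥#r = trans (cong (λ n → take n (#s s)) (length-#s r)) (trans (take-map (length r) s) (cong #s s≥r))
    #r≡#s : #s r ≡ #s s
    #r≡#s = leaves-prefix-free T r-leaf s-leaf #s≥#r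

  shorter-than-common-prefix : ∀ {r s k} → InLᵣ r → InLᵣ s → r ≢ s →
                               take k r ≡ take k s → k ≤ length r → k < length r
  shorter-than-common-prefix {r} {s} {k} r-InL s-InL r≢s r≈s k≤r with k ℕ.≟ length r
  ... | no  k≢r = ℕP.≤∧≢⇒< k≤r k≢r
  ... | yes k≡r = ⊥-elim (r≢s (InLᵣ-prefix-free r-InL s-InL s≥r))
    where
    s≥r : take (length r) s ≡ r
    s≥r = begin
      take (length r) s ≡⟨ cong (λ n → take n s) (sym k≡r) ⟩
      take k s          ≡⟨ sym r≈s ⟩
      take k r          ≡⟨ cong (λ n → take n r) k≡r ⟩
      take (length r) r ≡⟨ take-all (length r) r ℕP.≤-refl ⟩
      r                 ∎
      where open ≡-Reasoning

  E-transfer : ∀ t {r s r′ s′} → InL r′ → InL s′ → #s r ≡ #s r′ → #s s ≡ #s s′ →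
               profile r s ≡ profile r′ s′ → E t r s → E t r′ s′
  E-transfer t r′-L s′-L #r≡ #s≡ same ((_ , r∈Dₜ) , (_ , s∈Dₜ) , r≈s) =
    (r′-L , subst (λ w → take (length t) w ≡ t) #r≡ r∈Dₜ) ,
    (s′-L , subst (λ w → take (length t) w ≡ t) #s≡ s∈Dₜ) ,
    take-≡-transfer (length t) same r≈s

  commonPrefix-transfer : ∀ {r s r′ s′} → InL r → InL s → #s r ≡ #s r′ →
                          (∀ t → IsNode T t → E t r s → E t r′ s′) → commonPrefix r s ≤ commonPrefix r′ s′
  commonPrefix-transfer {r} {s} {r′} {s′} r-L s-L #r≡#r′ E-pres
    with commonPrefix-take c r′ s′ (subst (λ m → take m r′ ≡ take m s′) length-t r′≈s′)
    where
    c : ℕ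
    c = commonPrefix r s
    -- the node of T below which r and s branch
    t : List ℕ
    t = take c (#s r)
    length-t : length t ≡ c
    length-t = length-take≤ c (#s r) (subst (c ≤_) (sym (length-#s r)) (commonPrefix≤length r s))
    r≈s : take c r ≡ take c s
    r≈s = take-commonPrefix r s ℕP.≤-refl
    r∈Dₜ : take (length t) (#s r) ≡ t
    r∈Dₜ = cong (λ m → take m (#s r)) length-t
    s∈Dₜ : take (length t) (#s s) ≡ t
    s∈Dₜ = begin
      take (length t) (#s s) ≡⟨ cong (λ m → take m (#s s)) length-t ⟩
      take c (#s s)          ≡⟨ take-map c s ⟩
      #s (take c s)          ≡⟨ cong #s r≈s ⟨
      #s (take c r)          ≡⟨ take-map c r ⟨
      t                      ∎
      where open ≡-Reasoning
    r′≈s′ : take (length t) r′ ≡ take (length t) s′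
    r′≈s′ = proj₂ (proj₂ (E-pres t (take-isNode T c (ℓL , proj₁ r-L))
              ((r-L , r∈Dₜ) , (s-L , s∈Dₜ) , subst (λ m → take m r ≡ take m s) (sym length-t) r≈s)))
  ... | inj₁ c≤ = c≤
  ... | inj₂ refl = subst (commonPrefix r s ≤_) (cong proj₁ (sym (profile-refl r′)))
                      (ℕP.≤-trans (commonPrefix≤length r s) (ℕP.≤-reflexive (#s-≡⇒length-≡ #r≡#r′)))

  Pair : Set
  Pair = List ℚ × List ℚ

  -- A finite partial isomorphism of 𝓛*_T, given by its graph: by E-transfer and
  -- commonPrefix-transfer, preserving #s and profiles amounts to preserving <, = and every E_t.
  record PartialIso (st : List Pair) : Set where
    field
      dom-InL      : ∀ {p} → p ∈ st → InLᵣ (proj₁ p)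
      img-InL      : ∀ {p} → p ∈ st → InLᵣ (proj₂ p)
      #s-pres      : ∀ {p} → p ∈ st → #s (proj₁ p) ≡ #s (proj₂ p)
      profile-pres : ∀ {p q} → p ∈ st → q ∈ st → profile (proj₁ p) (proj₁ q) ≡ profile (proj₂ p) (proj₂ q)

  ValidImage : List Pair → List ℚ → List ℚ → Set
  ValidImage st x y = InLᵣ y × #s x ≡ #s y × (∀ {q} → q ∈ st → profile x (proj₁ q) ≡ profile y (proj₂ q))

  PartialIso-∷ : ∀ {st x y} → PartialIso st → InLᵣ x → ValidImage st x y → PartialIso ((x , y) ∷ st)
  PartialIso-∷ {st} {x} {y} iso x-InL (y-InL , #x≡#y , x↦y) = record
    { dom-InL = λ { (here refl) → x-InL ; (there p∈) → dom-InL p∈ }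
    ; img-InL = λ { (here refl) → y-InL ; (there p∈) → img-InL p∈ }
    ; #s-pres = λ { (here refl) → #x≡#y ; (there p∈) → #s-pres p∈ }
    ; profile-pres = profile-pres′
    }
    where
    open PartialIso iso
    profile-pres′ : ∀ {p q} → p ∈ (x , y) ∷ st → q ∈ (x , y) ∷ st →
                    profile (proj₁ p) (proj₁ q) ≡ profile (proj₂ p) (proj₂ q)
    profile-pres′ (here refl) (here refl) =
      trans (profile-refl x) (trans (cong (_, equal) (#s-≡⇒length-≡ #x≡#y)) (sym (profile-refl y)))
    profile-pres′ (here refl) (there q∈) = x↦y q∈
    profile-pres′ {p} (there p∈) (here refl) =
      trans (profile-sym x (proj₁ p)) (trans (cong oppositeProfile (x↦y p∈)) (sym (profile-sym y (proj₂ p))))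
    profile-pres′ (there p∈) (there q∈) = profile-pres p∈ q∈

  -- The image of x will be v ++ z ∷ xᵣ for a suitable z (see validImage-with).
  module OnePointExtension
    {st : List Pair} (iso : PartialIso st) {x : List ℚ} (x-InL : InLᵣ x)
    {a b : List ℚ} (ab∈ : (a , b) ∈ st)
    (a-closest : ∀ {q} → q ∈ st → commonPrefix x (proj₁ q) ≤ commonPrefix x a)
    (x∉ : ∀ {q} → q ∈ st → proj₁ q ≢ x) where
    open PartialIso iso

    k : ℕ
    k = commonPrefix x a

    u v : List ℚ
    u = take k x
    v = take k b

    x≈a : take k x ≡ take k a
    x≈a = take-commonPrefix x a ℕP.≤-refl

    k<x : k < length x
    k<x = shorter-than-common-prefix x-InL (dom-InL ab∈) (λ x≡a → x∉ ab∈ (sym x≡a)) x≈a (commonPrefix≤length x a)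

    k<a : k < length a
    k<a = shorter-than-common-prefix (dom-InL ab∈) x-InL (x∉ ab∈) (sym x≈a) (commonPrefix≤lengthʳ x a)

    k≤b : k ≤ length b
    k≤b = subst (k ≤_) (#s-≡⇒length-≡ (#s-pres ab∈)) (ℕP.<⇒≤ k<a)

    xₖ : ℚ
    xₖ = entry x k

    xᵣ : List ℚ
    xᵣ = drop (suc k) x

    x-split : x ≡ u ++ xₖ ∷ xᵣ
    x-split = split-at k x k<x

    length-u : length u ≡ k
    length-u = length-take≤ k x (ℕP.<⇒≤ k<x)

    length-v : length v ≡ k
    length-v = length-take≤ k b k≤b

    #v≡#u : #s v ≡ #s u
    #v≡#u = begin
      #s (take k b)  ≡⟨ take-map k b ⟨
      take k (#s b)  ≡⟨ cong (take k) (#s-pres ab∈) ⟨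
      take k (#s a)  ≡⟨ take-map k a ⟩
      #s (take k a)  ≡⟨ cong #s x≈a ⟨
      #s (take k x)  ∎
      where open ≡-Reasoning

    xₖ-canonical : SumCanonical (#s u) (xₖ ∷ xᵣ)
    xₖ-canonical = proj₂ (sumCanonical-++⁻ [] u (xₖ ∷ xᵣ) (subst (SumCanonical []) x-split (proj₂ x-InL)))

    v-canonical : SumCanonical [] v
    v-canonical = proj₁ (sumCanonical-++⁻ [] v (drop k b)
                    (subst (SumCanonical []) (sym (take++drop≡id k b)) (proj₂ (img-InL ab∈))))

    -- A pair (a′ , b′) of st whose domain point also starts with u.
    module Branch {a′ b′ : List ℚ} (j∈ : (a′ , b′) ∈ st) (k≤ : k ≤ commonPrefix a a′) where
      a′≈u : take k a′ ≡ u
      a′≈u = trans (sym (take-commonPrefix a a′ k≤)) (sym x≈a)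

      b′≈v : take k b′ ≡ v
      b′≈v = sym (take-commonPrefix b b′ (subst (k ≤_) (cong proj₁ (profile-pres ab∈ j∈)) k≤))

      k<a′ : k < length a′
      k<a′ = shorter-than-common-prefix (dom-InL j∈) x-InL (x∉ j∈) a′≈u
               (ℕP.≤-trans k≤ (commonPrefix≤lengthʳ a a′))

      k<b′ : k < length b′
      k<b′ = subst (k <_) (#s-≡⇒length-≡ (#s-pres j∈)) k<a′

      aₖ bₖ : ℚ
      aₖ = entry a′ k
      bₖ = entry b′ k

      aᵣ bᵣ : List ℚ
      aᵣ = drop (suc k) a′
      bᵣ = drop (suc k) b′

      a′-split : a′ ≡ u ++ aₖ ∷ aᵣ
      a′-split = trans (split-at k a′ k<a′) (cong (_++ aₖ ∷ aᵣ) a′≈u)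

      b′-split : b′ ≡ v ++ bₖ ∷ bᵣ
      b′-split = trans (split-at k b′ k<b′) (cong (_++ bₖ ∷ bᵣ) b′≈v)

      profile-x-a′ : profile x a′ ≡ shiftProfile (length u) (extendProfile (compareℚ xₖ aₖ) (profile xᵣ aᵣ))
      profile-x-a′ = trans (cong₂ profile x-split a′-split) (profile-++ u (xₖ ∷ xᵣ) (aₖ ∷ aᵣ))

      -- Otherwise x would share a longer prefix with a′ than with a.
      xₖ≢aₖ : compareℚ xₖ aₖ ≢ equal
      xₖ≢aₖ e = ℕP.<-irrefl refl (ℕP.<-≤-trans k<cp (a-closest j∈))
        where
        c : ℕ
        c = proj₁ (extendProfile (compareℚ xₖ aₖ) (profile xᵣ aᵣ))
        1≤c : 1 ≤ c
        1≤c = subst (λ o → 1 ≤ proj₁ (extendProfile o (profile xᵣ aᵣ))) (sym e) (extendProfile-equal (profile xᵣ aᵣ))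
        k<cp : k < commonPrefix x a′
        k<cp = begin-strict
          k                  <⟨ ℕP.m<m+n k 1≤c ⟩
          k + c              ≡⟨ cong (_+ c) length-u ⟨
          length u + c       ≡⟨ cong proj₁ profile-x-a′ ⟨
          commonPrefix x a′  ∎
          where open ℕP.≤-Reasoning

      aₖ-canonical : SumCanonical (#s u) (aₖ ∷ aᵣ)
      aₖ-canonical = proj₂ (sumCanonical-++⁻ [] u (aₖ ∷ aᵣ) (subst (SumCanonical []) a′-split (proj₂ (dom-InL j∈))))

      bₖ-canonical : SumCanonical (#s v) (bₖ ∷ bᵣ)
      bₖ-canonical = proj₂ (sumCanonical-++⁻ [] v (bₖ ∷ bᵣ) (subst (SumCanonical []) b′-split (proj₂ (img-InL j∈))))

      #aₖ≡#bₖ : # aₖ ≡ # bₖ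
      #aₖ≡#bₖ = proj₁ (∷-injective (++-cancelˡ (#s u) _ _ (begin
        #s u ++ #s (aₖ ∷ aᵣ) ≡⟨ map-++ # u (aₖ ∷ aᵣ) ⟨
        #s (u ++ aₖ ∷ aᵣ)    ≡⟨ cong #s a′-split ⟨
        #s a′                ≡⟨ #s-pres j∈ ⟩
        #s b′                ≡⟨ cong #s b′-split ⟩
        #s (v ++ bₖ ∷ bᵣ)    ≡⟨ map-++ # v (bₖ ∷ bᵣ) ⟩
        #s v ++ #s (bₖ ∷ bᵣ) ≡⟨ cong (_++ #s (bₖ ∷ bᵣ)) #v≡#u ⟩
        #s u ++ #s (bₖ ∷ bᵣ) ∎)))
        where open ≡-Reasoning

      profile-image : ∀ z → compareℚ z bₖ ≡ compareℚ xₖ aₖ → profile x a′ ≡ profile (v ++ z ∷ xᵣ) b′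
      profile-image z z≟bₖ = begin
        profile x a′
          ≡⟨ profile-x-a′ ⟩
        shiftProfile (length u) (extendProfile (compareℚ xₖ aₖ) (profile xᵣ aᵣ))
          ≡⟨ cong₂ shiftProfile (trans length-u (sym length-v))
                (trans (extendProfile-≢equal _ _ xₖ≢aₖ) (cong (λ o → extendProfile o (profile xᵣ bᵣ)) (sym z≟bₖ))) ⟩
        shiftProfile (length v) (extendProfile (compareℚ z bₖ) (profile xᵣ bᵣ))
          ≡⟨ profile-++ v (z ∷ xᵣ) (bₖ ∷ bᵣ) ⟨
        profile (v ++ z ∷ xᵣ) (v ++ bₖ ∷ bᵣ)
          ≡⟨ cong (profile (v ++ z ∷ xᵣ)) b′-split ⟨
        profile (v ++ z ∷ xᵣ) b′
          ∎
        where open ≡-Reasoning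

    kthEntries : Pair → ℚ × ℚ
    kthEntries (a′ , b′) = entry a′ k , entry b′ k

    branches? : (q : Pair) → Dec (k ≤ commonPrefix a (proj₁ q))
    branches? q = k ≤? commonPrefix a (proj₁ q)

    branchEntries : List (ℚ × ℚ)
    branchEntries = map kthEntries (filter branches? st)

    branch-order : ∀ {a₁ b₁ a₂ b₂} (j₁ : (a₁ , b₁) ∈ st) (k≤₁ : k ≤ commonPrefix a a₁)
                     (j₂ : (a₂ , b₂) ∈ st) (k≤₂ : k ≤ commonPrefix a a₂) →
                   compareℚ (entry a₁ k) (entry a₂ k) ≡ compareℚ (entry b₁ k) (entry b₂ k)
    branch-order {a₁} {b₁} {a₂} {b₂} j₁ k≤₁ j₂ k≤₂ =
      extendProfile-injectiveˡ _ _ (shiftProfile-injective k (begin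
        shiftProfile k Rᵃ                                 ≡⟨ cong (λ n → shiftProfile n Rᵃ) length-u ⟨
        shiftProfile (length u) Rᵃ                        ≡⟨ profile-++ u (J₁.aₖ ∷ J₁.aᵣ) (J₂.aₖ ∷ J₂.aᵣ) ⟨
        profile (u ++ J₁.aₖ ∷ J₁.aᵣ) (u ++ J₂.aₖ ∷ J₂.aᵣ) ≡⟨ cong₂ profile J₁.a′-split J₂.a′-split ⟨
        profile a₁ a₂                                     ≡⟨ profile-pres j₁ j₂ ⟩
        profile b₁ b₂                                     ≡⟨ cong₂ profile J₁.b′-split J₂.b′-split ⟩
        profile (v ++ J₁.bₖ ∷ J₁.bᵣ) (v ++ J₂.bₖ ∷ J₂.bᵣ) ≡⟨ profile-++ v (J₁.bₖ ∷ J₁.bᵣ) (J₂.bₖ ∷ J₂.bᵣ) ⟩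
        shiftProfile (length v) Rᵇ                        ≡⟨ cong (λ n → shiftProfile n Rᵇ) length-v ⟩
        shiftProfile k Rᵇ                                 ∎))
      where
      open ≡-Reasoning
      module J₁ = Branch j₁ k≤₁
      module J₂ = Branch j₂ k≤₂
      Rᵃ Rᵇ : Profile
      Rᵃ = extendProfile (compareℚ J₁.aₖ J₂.aₖ) (profile J₁.aᵣ J₂.aᵣ)
      Rᵇ = extendProfile (compareℚ J₁.bₖ J₂.bₖ) (profile J₁.bᵣ J₂.bᵣ)

    branchEntries-order : ∀ {w w′} → w ∈ branchEntries → w′ ∈ branchEntries →
                          compareℚ (proj₁ w) (proj₁ w′) ≡ compareℚ (proj₂ w) (proj₂ w′)
    branchEntries-order w∈ w′∈ with ∈-map∘filter⁻ kthEntries branches? w∈ | ∈-map∘filter⁻ kthEntries branches? w′∈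
    ... | _ , j∈ , refl , k≤ | _ , j′∈ , refl , k≤′ = branch-order j∈ k≤ j′∈ k≤′

    validImage-with : ∀ z → # z ≡ # xₖ → (lab T (#s u) ≡ just sL → z ≡ ℕtoℚ (# z)) →
                      (∀ {a′ b′} → (a′ , b′) ∈ st → k ≤ commonPrefix a a′ →
                        compareℚ z (entry b′ k) ≡ compareℚ xₖ (entry a′ k)) →
                      ValidImage st x (v ++ z ∷ xᵣ)
    validImage-with z #z≡#xₖ z-canonical same-cut =
      (subst (λ w → lab T w ≡ just ℓL) #x≡#y (proj₁ x-InL) , y-canonical) , #x≡#y , profile-x≡profile-y
      where
      y : List ℚ
      y = v ++ z ∷ xᵣ

      #x≡#y : #s x ≡ #s y
      #x≡#y = begin
        #s x                 ≡⟨ cong #s x-split ⟩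
        #s (u ++ xₖ ∷ xᵣ)    ≡⟨ map-++ # u (xₖ ∷ xᵣ) ⟩
        #s u ++ # xₖ ∷ #s xᵣ ≡⟨ cong₂ (λ A B → A ++ B ∷ #s xᵣ) (sym #v≡#u) (sym #z≡#xₖ) ⟩
        #s v ++ # z ∷ #s xᵣ  ≡⟨ map-++ # v (z ∷ xᵣ) ⟨
        #s y                 ∎
        where open ≡-Reasoning

      y-canonical : SumCanonical [] y
      y-canonical = sumCanonical-++⁺ [] v (z ∷ xᵣ) v-canonical
        ( (λ sum → z-canonical (subst (λ w → lab T w ≡ just sL) #v≡#u sum))
        , subst (λ w → SumCanonical w xᵣ) (cong₂ (λ A B → A ++ B ∷ []) (sym #v≡#u) (sym #z≡#xₖ)) (proj₂ xₖ-canonical))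

      profile-x≡profile-y : ∀ {q} → q ∈ st → profile x (proj₁ q) ≡ profile y (proj₂ q)
      profile-x≡profile-y {a′ , b′} j∈ with k ≤? commonPrefix a a′
      ... | yes k≤ = Branch.profile-image j∈ k≤ z (same-cut j∈ k≤)
      ... | no  k≰ = begin
        profile x a′ ≡⟨ profile-beyond-commonPrefix k a′ (sym x≈a) cp<k ⟩
        profile a a′ ≡⟨ profile-pres ab∈ j∈ ⟩
        profile b b′ ≡⟨ profile-beyond-commonPrefix k b′ (sym (take-++-take k b (z ∷ xᵣ) k≤b))
                          (subst (_< k) (cong proj₁ (profile-pres ab∈ j∈)) cp<k) ⟨
        profile y b′ ∎
        where
        open ≡-Reasoning
        cp<k : commonPrefix a a′ < k
        cp<k = ℕP.≰⇒> k≰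

    validImage : Σ (List ℚ) (ValidImage st x)
    validImage with Maybe.≡-dec _≟ᴸ_ (lab T (#s u)) (just sL)
    ... | yes sum = v ++ xₖ ∷ xᵣ , validImage-with xₖ refl (proj₁ xₖ-canonical) xₖ-cut
      where
      -- At a sum node all k-th entries are forced: they are the natural numbers indexing them.
      xₖ-cut : ∀ {a′ b′} (j∈ : (a′ , b′) ∈ st) (k≤ : k ≤ commonPrefix a a′) →
               compareℚ xₖ (entry b′ k) ≡ compareℚ xₖ (entry a′ k)
      xₖ-cut j∈ k≤ = cong (compareℚ xₖ) (begin
        bₖ              ≡⟨ proj₁ bₖ-canonical (subst (λ w → lab T w ≡ just sL) (sym #v≡#u) sum) ⟩
        ℕtoℚ (# bₖ)     ≡⟨ cong ℕtoℚ #aₖ≡#bₖ ⟨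
        ℕtoℚ (# aₖ)     ≡⟨ proj₁ aₖ-canonical sum ⟨
        aₖ              ∎)
        where
        open ≡-Reasoning
        open Branch j∈ k≤
    ... | no  not-sum with extend-finiteOrderIso P branchEntries branchEntries-order xₖ xₖ∉ (# xₖ) (#-pos xₖ)
      where
      xₖ∉ : ∀ {w} → w ∈ branchEntries → compareℚ xₖ (proj₁ w) ≢ equal
      xₖ∉ w∈ with ∈-map∘filter⁻ kthEntries branches? w∈
      ... | _ , j∈ , refl , k≤ = Branch.xₖ≢aₖ j∈ k≤
    ... | z , #z , z-cut =
      v ++ z ∷ xᵣ , validImage-with z #z (λ sum → ⊥-elim (not-sum sum))
                      (λ {a′} {b′} j∈ k≤ → z-cut (∈-map∘filter⁺ kthEntries branches? ((a′ , b′) , j∈ , refl , k≤)))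

  extend : ∀ {st} → PartialIso st → ∀ {x} → InLᵣ x → Σ (List ℚ) (ValidImage st x)
  extend {[]}     _   {x} x-InL = x , x-InL , refl , λ ()
  extend {p ∷ st} iso {x} x-InL with Any.any? (λ q → List.≡-dec ℚ._≟_ (proj₁ q) x) (p ∷ st)
  ... | yes x∈dom with find x∈dom
  ...   | (a , b) , ab∈ , refl = b , img-InL ab∈ , #s-pres ab∈ , profile-pres ab∈
    where open PartialIso iso
  extend {p ∷ st} iso {x} x-InL | no x∉dom with maximiser (λ q → commonPrefix x (proj₁ q)) p st
  ... | (a , b) , ab∈ , closest =
    OnePointExtension.validImage iso x-InL ab∈ closest (λ q∈ q≡x → x∉dom (Any.map (λ { refl → q≡x }) q∈))

  PartialIso-swap : ∀ {st} → PartialIso st → PartialIso (map swap st)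
  PartialIso-swap iso = record
    { dom-InL      = λ p∈ → img-InL (∈-map-swap⁻ p∈)
    ; img-InL      = λ p∈ → dom-InL (∈-map-swap⁻ p∈)
    ; #s-pres      = λ p∈ → sym (#s-pres (∈-map-swap⁻ p∈))
    ; profile-pres = λ p∈ q∈ → sym (profile-pres (∈-map-swap⁻ p∈) (∈-map-swap⁻ q∈))
    }
    where open PartialIso iso

  State : Set
  State = Σ (List Pair) PartialIso

  _⊑_ : State → State → Set
  s ⊑ s′ = ∀ {p} → p ∈ proj₁ s → p ∈ proj₁ s′

  swapState : State → State
  swapState (st , iso) = map swap st , PartialIso-swap iso

  forth : List ℚ → State → State
  forth x (st , iso) with inLᵣ? x
  ... | yes x-InL = (x , proj₁ (extend iso x-InL)) ∷ st , PartialIso-∷ iso x-InL (proj₂ (extend iso x-InL))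
  ... | no  _     = st , iso

  back : List ℚ → State → State
  back y s = swapState (forth y (swapState s))

  forth-⊒ : ∀ x s → s ⊑ forth x s
  forth-⊒ x (st , iso) p∈ with inLᵣ? x
  ... | yes _ = there p∈
  ... | no  _ = p∈

  back-⊒ : ∀ y s → s ⊑ back y s
  back-⊒ y s p∈ = ∈-map⁺ swap (forth-⊒ y (swapState s) (∈-map⁺ swap p∈))

  forth-dom : ∀ {x} s → InLᵣ x → ∃ λ y → (x , y) ∈ proj₁ (forth x s)
  forth-dom {x} (st , iso) x-InL with inLᵣ? x
  ... | yes _     = _ , here refl
  ... | no  x∉L   = ⊥-elim (x∉L x-InL)

  back-img : ∀ {y} s → InLᵣ y → ∃ λ x → (x , y) ∈ proj₁ (back y s)
  back-img {y} s y-InL with forth-dom (swapState s) y-InL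
  ... | x , yx∈ = x , ∈-map⁺ swap yx∈

  step : List ℚ → State → State
  step x s = back x (forth x s)

  step-⊒ : ∀ x s → s ⊑ step x s
  step-⊒ x s p∈ = back-⊒ x (forth x s) (forth-⊒ x s p∈)

  stepAll : List (List ℚ) → State → State
  stepAll []       s = s
  stepAll (x ∷ xs) s = stepAll xs (step x s)

  stepAll-⊒ : ∀ xs s → s ⊑ stepAll xs s
  stepAll-⊒ []       s p∈ = p∈
  stepAll-⊒ (x ∷ xs) s p∈ = stepAll-⊒ xs (step x s) (step-⊒ x s p∈)

  stepAll-dom : ∀ {xs x} s → x ∈ xs → InLᵣ x → ∃ λ y → (x , y) ∈ proj₁ (stepAll xs s)
  stepAll-dom {x ∷ xs} s (here refl) x-InL with forth-dom s x-InL
  ... | y , xy∈ = y , stepAll-⊒ xs (step x s) (back-⊒ x (forth x s) xy∈)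
  stepAll-dom {_ ∷ xs} s (there x∈) x-InL = stepAll-dom (step _ s) x∈ x-InL

  stepAll-img : ∀ {xs y} s → y ∈ xs → InLᵣ y → ∃ λ x → (x , y) ∈ proj₁ (stepAll xs s)
  stepAll-img {y ∷ xs} s (here refl) y-InL with back-img (forth y s) y-InL
  ... | x , xy∈ = x , stepAll-⊒ xs (step y s) xy∈
  stepAll-img {_ ∷ xs} s (there y∈) y-InL = stepAll-img (step _ s) y∈ y-InL

  module BackAndForth (s₀ : State) where
    stage : ℕ → State
    stage zero    = s₀
    stage (suc n) = stepAll (listsUpTo n) (stage n)

    stage-mono : ∀ {m n} → m ≤′ n → stage m ⊑ stage n
    stage-mono ≤′-refl                   p∈ = p∈
    stage-mono {n = suc n} (≤′-step m≤′n) p∈ = stepAll-⊒ (listsUpTo n) (stage n) (stage-mono m≤′n p∈)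

    Limit : Pair → Set
    Limit p = ∃ λ m → p ∈ proj₁ (stage m)

    profile-pres : ∀ {p q} → Limit p → Limit q → profile (proj₁ p) (proj₁ q) ≡ profile (proj₂ p) (proj₂ q)
    profile-pres (m , p∈) (m′ , q∈) =
      PartialIso.profile-pres (proj₂ (stage (m + m′)))
        (stage-mono (ℕP.≤⇒≤′ (ℕP.m≤m+n m m′)) p∈) (stage-mono (ℕP.≤⇒≤′ (ℕP.m≤n+m m′ m)) q∈)

    Limit-iso : ∀ {p} → Limit p → InLᵣ (proj₁ p) × InLᵣ (proj₂ p) × #s (proj₁ p) ≡ #s (proj₂ p)
    Limit-iso (m , p∈) = dom-InL p∈ , img-InL p∈ , #s-pres p∈
      where open PartialIso (proj₂ (stage m))

    image : ∀ {x} → InLᵣ x → ∃ λ y → Limit (x , y)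
    image {x} x-InL with stepAll-dom (stage (size x)) (∈-listsUpTo (size x) x ℕP.≤-refl) x-InL
    ... | y , xy∈ = y , suc (size x) , xy∈

    preimage : ∀ {y} → InLᵣ y → ∃ λ x → Limit (x , y)
    preimage {y} y-InL with stepAll-img (stage (size y)) (∈-listsUpTo (size y) y ℕP.≤-refl) y-InL
    ... | x , xy∈ = x , suc (size y) , xy∈

    f g : List ℚ → List ℚ
    f x with inLᵣ? x
    ... | yes x-InL = proj₁ (image x-InL)
    ... | no  _     = x
    g y with inLᵣ? y
    ... | yes y-InL = proj₁ (preimage y-InL)
    ... | no  _     = y

    f-graph : ∀ {x} → InL x → Limit (x , f x)
    f-graph {x} x-L with inLᵣ? x
    ... | yes x-InL = proj₂ (image x-InL)
    ... | no  x∉L   = ⊥-elim (x∉L (InL⇒InLᵣ x-L))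

    g-graph : ∀ {y} → InL y → Limit (g y , y)
    g-graph {y} y-L with inLᵣ? y
    ... | yes y-InL = proj₂ (preimage y-InL)
    ... | no  y∉L   = ⊥-elim (y∉L (InL⇒InLᵣ y-L))

    f-InL : ∀ {r} → InL r → InL (f r)
    f-InL r-L = InLᵣ⇒InL (proj₁ (proj₂ (Limit-iso (f-graph r-L))))

    g-InL : ∀ {r} → InL r → InL (g r)
    g-InL r-L = InLᵣ⇒InL (proj₁ (Limit-iso (g-graph r-L)))

    f-#s : ∀ {r} → InL r → #s r ≡ #s (f r)
    f-#s r-L = proj₂ (proj₂ (Limit-iso (f-graph r-L)))

    f-profile : ∀ {r s} → InL r → InL s → profile r s ≡ profile (f r) (f s)
    f-profile r-L s-L = profile-pres (f-graph r-L) (f-graph s-L)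

    automorphism : Automorphism
    automorphism = record
      { f   = f
      ; g   = g
      ; f-L = λ _ → f-InL
      ; g-L = λ _ → g-InL
      ; gf  = λ r r-L → profile-≡⇒≡ {r = f r} (sym (profile-pres (g-graph (f-InL r-L)) (f-graph r-L))) refl
      ; fg  = λ r r-L → profile-≡⇒≡ {r = g r} (profile-pres (f-graph (g-InL r-L)) (g-graph r-L)) refl
      ; f-< = λ r s r-L s-L → let same = f-profile r-L s-L in
          mk⇔ (λ r<s → lexOrder⇒Lex-< (f r) (f s) (trans (cong proj₂ (sym same)) (Lex-<⇒lexOrder r<s)))
              (λ fr<fs → lexOrder⇒Lex-< r s (trans (cong proj₂ same) (Lex-<⇒lexOrder fr<fs)))
      ; f-E = λ t _ r s r-L s-L →
          mk⇔ (E-transfer t (f-InL r-L) (f-InL s-L) (f-#s r-L) (f-#s s-L) (f-profile r-L s-L))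
              (E-transfer t r-L s-L (sym (f-#s r-L)) (sym (f-#s s-L)) (sym (f-profile r-L s-L)))
      }

    f-extends : ∀ {a b} → (a , b) ∈ proj₁ s₀ → f a ≡ b
    f-extends {a} ab∈ =
      sym (profile-≡⇒≡ {r = a} (profile-pres (0 , ab∈) (f-graph (InLᵣ⇒InL (PartialIso.dom-InL (proj₂ s₀) ab∈)))) refl)

  module _ {n} {a b : Vec (List ℚ) n} (φ : FinitePartialIso n a b) where
    open FinitePartialIso φ

    private
      A B : Fin n → List ℚ
      A = Vec.lookup a
      B = Vec.lookup b

    -- E at the leaf #s (A i) holds of (A i , A i), so also of (B i , B i).
    #s-lookup-pres : ∀ i → #s (A i) ≡ #s (B i)
    #s-lookup-pres i = leaves-prefix-free T (proj₁ (a-L i)) (proj₁ (b-L i)) (proj₂ (proj₁ Bi-E-Bi))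
      where
      Ai-E-Ai : E (#s (A i)) (A i) (A i)
      Ai-E-Ai = (a-L i , take-all _ _ ℕP.≤-refl) , (a-L i , take-all _ _ ℕP.≤-refl) , refl
      Bi-E-Bi : E (#s (A i)) (B i) (B i)
      Bi-E-Bi = Equivalence.to (pres-E (#s (A i)) (ℓL , proj₁ (a-L i)) i i) Ai-E-Ai

    lexOrder-lookup-pres : ∀ i j → lexOrder (A i) (A j) ≡ lexOrder (B i) (B j)
    lexOrder-lookup-pres i j with lexOrder (A i) (A j) in Ai≟Aj
    ... | less    = sym (Lex-<⇒lexOrder (Equivalence.to (pres-< i j) (lexOrder⇒Lex-< (A i) (A j) Ai≟Aj)))
    ... | equal   = sym (trans (cong (lexOrder (B i)) (sym Bi≡Bj)) (cong proj₂ (profile-refl (B i))))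
      where
      Bi≡Bj : B i ≡ B j
      Bi≡Bj = Equivalence.to (bij i j) (lexOrder-equal⁻ (A i) (A j) Ai≟Aj)
    ... | greater = sym (trans (cong proj₂ (profile-sym (B j) (B i))) (cong opposite Bj<Bi))
      where
      Aj<Ai : lexOrder (A j) (A i) ≡ less
      Aj<Ai = trans (cong proj₂ (profile-sym (A i) (A j))) (cong opposite Ai≟Aj)
      Bj<Bi : lexOrder (B j) (B i) ≡ less
      Bj<Bi = Lex-<⇒lexOrder (Equivalence.to (pres-< j i) (lexOrder⇒Lex-< (A j) (A i) Aj<Ai))

    profile-lookup-pres : ∀ i j → profile (A i) (A j) ≡ profile (B i) (B j)
    profile-lookup-pres i j = cong₂ _,_
      (ℕP.≤-antisym
        (commonPrefix-transfer (a-L i) (a-L j) (#s-lookup-pres i) (λ t t-node → Equivalence.to (pres-E t t-node i j)))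
        (commonPrefix-transfer (b-L i) (b-L j) (sym (#s-lookup-pres i)) (λ t t-node → Equivalence.from (pres-E t t-node i j))))
      (lexOrder-lookup-pres i j)

    graph : List Pair
    graph = map (λ i → A i , B i) (allFin n)

    graph-iso : PartialIso graph
    graph-iso = record
      { dom-InL      = λ p∈ → let i , p≡ = ∈-graph⁻ p∈ in subst (InLᵣ ∘ proj₁) (sym p≡) (InL⇒InLᵣ (a-L i))
      ; img-InL      = λ p∈ → let i , p≡ = ∈-graph⁻ p∈ in subst (InLᵣ ∘ proj₂) (sym p≡) (InL⇒InLᵣ (b-L i))
      ; #s-pres      = λ p∈ → let i , p≡ = ∈-graph⁻ p∈ in
                              subst (λ p → #s (proj₁ p) ≡ #s (proj₂ p)) (sym p≡) (#s-lookup-pres i)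
      ; profile-pres = λ p∈ q∈ → let i , p≡ = ∈-graph⁻ p∈ ; j , q≡ = ∈-graph⁻ q∈ in
                                 subst₂ (λ p q → profile (proj₁ p) (proj₁ q) ≡ profile (proj₂ p) (proj₂ q))
                                        (sym p≡) (sym q≡) (profile-lookup-pres i j)
      }
      where
      ∈-graph⁻ : ∀ {p} → p ∈ graph → ∃ λ i → p ≡ (A i , B i)
      ∈-graph⁻ p∈ = let i , _ , p≡ = ∈-map⁻ (λ i → A i , B i) p∈ in i , p≡

  ultrahomogeneous : Ultrahomogeneous
  ultrahomogeneous n a b φ = automorphism , λ i → f-extends (∈-map⁺ _ (∈-allFin i))
    where open BackAndForth (graph φ , graph-iso φ)

proposition11 : (P : DensePartition) (T : Tree) → Structure.Ultrahomogeneous P T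
proposition11 = ultrahomogeneous
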